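{- Let $P$ be a poset and $\prec$ an approximating auxiliary relation on $P$. Then the specialization order of the topological space $(P,\mu^\prec(P))$ coincides with the order $\le$ of $P$.
   Context: For a poset $(P,\le)$, $\mathord{\uparrow}X=\{x\mid\exists y\in X,\ y\le x\}$. A subset is directed if nonempty and every finite subset has an upper bound in it. An auxiliary relation on $P$ is a binary relation $\prec$ such that: $x\prec y$ implies $x\le y$; $u\le x\prec y\le z$ implies $u\prec z$; if $P$ has a least element $\bot$ then $\bot\prec x$ for all $x$. Write $s_\prec(x)=\{y\mid y\prec x\}$; $\prec$ is approximating if every $s_\prec(x)$ is directed with $\bigvee s_\prec(x)=x$. For $A\subseteq P$, $A^{\downarrow\prec}=\{x\in A\mid s_\prec(x)\cap A\ne\emptyset\}$. $U$ is $\prec$-open if $U=\mathord{\uparrow}U$ and $U=U^{\downarrow\prec}$; $\mu^\prec(P)$ is the topology of $\prec$-open sets. The specialization order of a topological space is $x\sqsubseteq y$ iff $x$ lies in the closure of $\{y\}$ (equivalently, every open set containing $x$ contains $y$). -}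

module Defs where

open import Level using (Level; suc)
open import Data.Product using (Σ; _×_; ∃; ∃-syntax)
open import Data.List using (List)
open import Data.List.Relation.Unary.All using (All)
open import Relation.Unary using (Pred; _∈_; _⊆_)
open import Relation.Binary using (Rel)
open import Relation.Binary.Bundles using (Poset)

module _ {ℓ : Level} (P : Poset ℓ ℓ ℓ) where
  open Poset P renaming (Carrier to X)

  ↑ : Pred X ℓ → Pred X ℓ
  ↑ A x = ∃[ y ] (y ∈ A × y ≤ x)

  -- directed: nonempty and every finite subset has an upper bound in it
  -- (the empty list encodes nonemptiness)
  Directed : Pred X ℓ → Set ℓ
  Directed D = (xs : List X) → All (_∈ D) xs → ∃[ u ] (u ∈ D × All (_≤ u) xs)

  IsJoin : Pred X ℓ → X → Set ℓ
  IsJoin A x = (∀ y → y ∈ A → y ≤ x) × (∀ z → (∀ y → y ∈ A → y ≤ z) → x ≤ z)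

  record IsAuxiliary (_≺_ : Rel X ℓ) : Set ℓ where
    field
      ≺⇒≤    : ∀ {x y} → x ≺ y → x ≤ y
      ≤≺≤⇒≺  : ∀ {u x y z} → u ≤ x → x ≺ y → y ≤ z → u ≺ z
      bottom : ∀ b → (∀ x → b ≤ x) → ∀ x → b ≺ x

  s : Rel X ℓ → X → Pred X ℓ
  s _≺_ x y = y ≺ x

  IsApproximating : Rel X ℓ → Set ℓ
  IsApproximating _≺_ = ∀ x → Directed (s _≺_ x) × IsJoin (s _≺_ x) x

  down≺ : Rel X ℓ → Pred X ℓ → Pred X ℓ
  down≺ _≺_ A x = x ∈ A × ∃[ y ] (y ≺ x × y ∈ A)

  IsOpen≺ : Rel X ℓ → Pred X ℓ → Set ℓ
  IsOpen≺ _≺_ U = (U ⊆ ↑ U × ↑ U ⊆ U) × (U ⊆ down≺ _≺_ U × down≺ _≺_ U ⊆ U)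

  Specialization : Rel X ℓ → X → X → Set (suc ℓ)
  Specialization _≺_ x y = (U : Pred X ℓ) → IsOpen≺ _≺_ U → x ∈ U → y ∈ U

-- Every ≺-open set is an upper set, so ≤ is contained in the specialization
-- order.  Conversely, if x ≰ y then the complement of ↓y is ≺-open: it is an
-- upper set, and an element z ≰ y must have an approximant w ≺ z with w ≰ y,
-- since otherwise y would bound s≺(z) and z = ⋁ s≺(z) ≤ y.  This open set
-- separates x from y.
module Submission where

open import Defs
open import Level using (Level)
open import Data.Product using (_×_; _,_; proj₁; proj₂; ∃-syntax)
open import Function using (_∘_)
open import Relation.Binary using (Rel)
open import Relation.Binary.Bundles using (Poset)
open import Relation.Unary using (Pred; _⊆_)
open import Relation.Nullary using (¬_)
open import Relation.Nullary.Negation using (¬∃⟶∀¬)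
open import Axiom.ExcludedMiddle using (ExcludedMiddle)
open import Axiom.DoubleNegationElimination using (em⇒dne)

module _ {ℓ : Level} (P : Poset ℓ ℓ ℓ) (_≺_ : Rel (Poset.Carrier P) ℓ) where
  open Poset P renaming (Carrier to X)

  open⇒↑-closed : ∀ {U} → IsOpen≺ P _≺_ U → ↑ P U ⊆ U
  open⇒↑-closed ((_ , ↑U⊆U) , _) = ↑U⊆U

  ≤⇒specialization : ∀ {x y} → x ≤ y → Specialization P _≺_ x y
  ≤⇒specialization x≤y U U-open x∈U = open⇒↑-closed U-open (_ , x∈U , x≤y)

  ∁↓ : X → Pred X ℓ
  ∁↓ y z = ¬ (z ≤ y)

  ↑-∁↓ : ∀ y → ↑ P (∁↓ y) ⊆ ∁↓ y
  ↑-∁↓ y (w , w≰y , w≤z) z≤y = w≰y (trans w≤z z≤y)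

  module _ (em : ExcludedMiddle ℓ) (approximating : IsApproximating P _≺_) where

    approximant-∁↓ : ∀ {y z} → ¬ (z ≤ y) → ∃[ w ] (w ≺ z × ¬ (w ≤ y))
    approximant-∁↓ {y} {z} z≰y = em⇒dne em λ none →
      z≰y (proj₂ (proj₂ (approximating z)) y λ w w≺z →
        em⇒dne em (¬∃⟶∀¬ none w ∘ (w≺z ,_)))

    ∁↓-open : ∀ y → IsOpen≺ P _≺_ (∁↓ y)
    ∁↓-open y = ((λ z≰y → _ , z≰y , refl) , ↑-∁↓ y)
              , ((λ z≰y → z≰y , approximant-∁↓ z≰y) , proj₁)

    specialization⇒≤ : ∀ {x y} → Specialization P _≺_ x y → x ≤ y
    specialization⇒≤ {x} {y} x⊑y = em⇒dne em λ x≰y → x⊑y (∁↓ y) (∁↓-open y) x≰y refl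

proposition3p19 : {ℓ : Level} → ExcludedMiddle ℓ → (P : Poset ℓ ℓ ℓ) → (_≺_ : Rel (Poset.Carrier P) ℓ)
    → IsAuxiliary P _≺_ → IsApproximating P _≺_
    → ∀ x y → (Specialization P _≺_ x y → Poset._≤_ P x y) × (Poset._≤_ P x y → Specialization P _≺_ x y)
proposition3p19 em P _≺_ _ approximating x y =
  specialization⇒≤ P _≺_ em approximating , ≤⇒specialization P _≺_
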